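{- For every local epistemic model $\mathcal{M}=(W,\delta,\{R_a\}_{a\in\mathbf A},\rho)$, its properization $\mathcal{M}^{pr}$ is a proper local epistemic model such that for every $w\in W$, $\mathcal{M},w$ and $\mathcal{M}^{pr},[w]_\delta$ are bisimilar (and hence satisfy the same $\mathcal{L}^{[:=]}$-sentences). In particular, if $\mathcal{M}$ is already a proper local epistemic model, then $\mathcal{M}$ is isomorphic to $\mathcal{M}^{pr}$.
   Context: Fix a nonempty finite set $\mathbf{A}$ of agents, a countable set $\mathbf{X}$ of variables, and a countable set $\mathbf{P}$ of predicate letters. Formulas of $\mathcal{L}^{[:=]}$: $\phi ::= p_x \mid \top \mid \neg\phi \mid (\phi\wedge\phi) \mid [x:=a]\phi \mid \mathsf{K}_X\alpha$ ($p\in\mathbf P$, $x\in\mathbf X$, $a\in\mathbf A$, $X\subseteq\mathbf X$ finite, $\alpha$ a sentence, i.e. formula without free variables, where $[x:=a]$ binds $x$ and $FV(\mathsf K_X\alpha)=X$). A first-order Kripke model is $\mathcal{M}=(W,\delta,\{R_a\}_{a\in\mathbf{A}},\rho)$ with $W\neq\emptyset$, $\delta:W\to\wp(\mathbf{A})\setminus\{\emptyset\}$, $R_a\subseteq W\times W$ with $R_a(w)=\emptyset$ whenever $a\notin\delta(w)$, and $\rho:\mathbf{P}\times W\to\wp(\mathbf{A})$ with $\rho(p,w)\subseteq\delta(w)$. Sentences are evaluated with assignments $\sigma:\mathbf X\to\mathbf A$ (required to map free variables into $\delta(w)$): $\mathcal M,w,\sigma\vDash p_x$ iff $\sigma(x)\in\rho(p,w)$;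 Boolean clauses as usual; $\mathcal M,w,\sigma\vDash[x:=a]\phi$ iff ($a\in\delta(w)$ implies $\mathcal M,w,\sigma[x\mapsto a]\vDash\phi$); $\mathcal M,w,\sigma\vDash\mathsf K_X\alpha$ iff $\mathcal M,v,\sigma\vDash\alpha$ for all $v\in\bigcap_{a\in\sigma[X]}R_a(w)$ (empty intersection $=W$). $\mathcal M$ is a local epistemic model if: (Local S5) for each $a$, the restriction of $R_a$ to $\{w\mid a\in\delta(w)\}$ is an equivalence relation; (Individually Increasing Domain) if $a\in\delta(w)$ and $wR_av$ then $a\in\delta(v)$; (Local Predicates) if $a\in\rho(p,w)$ and $wR_av$ then $a\in\rho(p,v)$; (Collectively Decreasing Domain) if $v\in\bigcap_{a\in\delta(w)}R_a(w)$ then $\delta(v)\subseteq\delta(w)$. It is proper if moreover $\bigcap_{a\in\delta(w)}R_a(w)=\{w\}$ for all $w$. For a local epistemic model let $[w]_\delta=\bigcap_{a\in\delta(w)}R_a(w)$. The properization $\mathcal M^{pr}=(W^{pr},\delta^{pr},\{R^{pr}_a\},\rho^{pr})$ has $W^{pr}=\{[w]_\delta\mid w\in W\}$, $\delta^{pr}([w]_\delta)=\delta(w)$, $R^{pr}_a=\{([w]_\delta,[v]_\delta)\mid wR_av\}$, $\rho^{pr}(p,[w]_\delta)=\rho(p,w)$. A bisimulation between first-order Kripke models $\mathcal M,\mathcal N$ is $Z\subseteq W^{\mathcal M}\times W^{\mathcal N}$ such that for $(w,v)\in Z$: $\delta^{\mathcal M}(w)=\delta^{\mathcal N}(v)$ and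 $\rho^{\mathcal M}(p,w)=\rho^{\mathcal N}(p,v)$ for all $p$; for every $A\subseteq\mathbf A$ and $w'\in\bigcap_{a\in A}R^{\mathcal M}_a(w)$ there is $v'\in\bigcap_{a\in A}R^{\mathcal N}_a(v)$ with $(w',v')\in Z$; and symmetrically. Isomorphism means a bijection between worlds preserving $\delta$, each $R_a$, and $\rho$. -}

module Defs where

open import Data.Nat using (ℕ; suc)
import Data.Nat as ℕ
open import Data.Fin using (Fin)
open import Data.Fin.Subset using (Subset; _∈_; _∉_; _⊆_; Nonempty)
open import Data.Product using (Σ; ∃; ∃-syntax; _×_; _,_)
open import Data.List using (List; []; _∷_; filter)
open import Data.List.Membership.Propositional using () renaming (_∈_ to _∈ᴸ_)
open import Data.Unit using (⊤)
open import Relation.Binary.PropositionalEquality using (_≡_; _≢_)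
open import Relation.Binary.Structures using (IsEquivalence)
open import Relation.Nullary using (¬_; yes; no; ¬?)
open import Function.Bundles using (_⇔_)

-- Agents: Fin n (the theorem takes n = suc k, i.e. nonempty finite).
-- Variables: ℕ (countable).  Predicate letters: a type P (countable).
-- Subsets of agents: Data.Fin.Subset (finite, decidable).

Var : Set
Var = ℕ

-- Since Agda has no quotients,
-- the set of worlds is a setoid: a carrier W with a relation _≈_ (world
-- identity); all structure is required to respect _≈_ (see IsFOKripke).
record PreModel (n : ℕ) (P : Set) : Set₁ where
  field
    W   : Set
    _≈_ : W → W → Set
    δ   : W → Subset n
    R   : Fin n → W → W → Set
    ρ   : P → W → Subset n

module _ {n : ℕ} {P : Set} (M : PreModel n P) where
  open PreModel M

  InterR : Subset n → W → W → Set
  InterR A w v = ∀ a → a ∈ A → R a w v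

  Cell : W → W → Set
  Cell w v = InterR (δ w) w v

  record IsFOKripke : Set where
    field
      inhabited : W
      ≈-equiv   : IsEquivalence _≈_
      δ-resp    : ∀ {w w'} → w ≈ w' → δ w ≡ δ w'
      ρ-resp    : ∀ {p w w'} → w ≈ w' → ρ p w ≡ ρ p w'
      R-resp    : ∀ {a w w' v v'} → w ≈ w' → v ≈ v' → R a w v → R a w' v'
      δ-nonempty : ∀ w → Nonempty (δ w)
      R-dom     : ∀ {a w v} → a ∉ δ w → ¬ R a w v
      ρ-dom     : ∀ p w → ρ p w ⊆ δ w

  record IsLocalEpistemic : Set where
    field
      isFOKripke : IsFOKripke
      S5-refl  : ∀ {a w} → a ∈ δ w → R a w w
      S5-sym   : ∀ {a w v} → a ∈ δ w → a ∈ δ v → R a w v → R a v w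
      S5-trans : ∀ {a w v u} → a ∈ δ w → a ∈ δ v → a ∈ δ u →
                 R a w v → R a v u → R a w u
      incDom   : ∀ {a w v} → a ∈ δ w → R a w v → a ∈ δ v
      localPred : ∀ {p a w v} → a ∈ ρ p w → R a w v → a ∈ ρ p v
      decDom   : ∀ {w v} → Cell w v → δ v ⊆ δ w

  IsProper : Set
  IsProper = ∀ w v → Cell w v ⇔ (v ≈ w)

-- Properization.  A world [w]_δ of M^pr is represented by w; two
-- representatives denote the same world iff their cells are equal sets.
properization : ∀ {n P} → PreModel n P → PreModel n P
properization {n} {P} M = record
  { W   = W
  ; _≈_ = _≈pr_
  ; δ   = δ
  ; R   = λ a x y → ∃[ w ] ∃[ v ] (x ≈pr w × y ≈pr v × R a w v)
  ; ρ   = ρ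
  }
  where
    open PreModel M
    _≈pr_ : W → W → Set
    x ≈pr y = ∀ u → Cell M x u ⇔ Cell M y u

record IsBisimulation {n P} (M N : PreModel n P)
       (Z : PreModel.W M → PreModel.W N → Set) : Set where
  module M = PreModel M
  module N = PreModel N
  field
    Z-resp : ∀ {w w' v v'} → w M.≈ w' → v N.≈ v' → Z w v → Z w' v'
    δ-eq   : ∀ {w v} → Z w v → M.δ w ≡ N.δ v
    ρ-eq   : ∀ {w v} → Z w v → ∀ p → M.ρ p w ≡ N.ρ p v
    forth  : ∀ {w v} → Z w v → ∀ (A : Subset n) w' → InterR M A w w' →
             ∃[ v' ] (InterR N A v v' × Z w' v')
    back   : ∀ {w v} → Z w v → ∀ (A : Subset n) v' → InterR N A v v' →
             ∃[ w' ] (InterR M A w w' × Z w' v')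

Bisimilar : ∀ {n P} (M : PreModel n P) → PreModel.W M →
            (N : PreModel n P) → PreModel.W N → Set₁
Bisimilar M w N v =
  Σ (PreModel.W M → PreModel.W N → Set) λ Z → IsBisimulation M N Z × Z w v

record Isomorphic {n P} (M N : PreModel n P) : Set where
  module M = PreModel M
  module N = PreModel N
  field
    f      : M.W → N.W
    g      : N.W → M.W
    f-resp : ∀ {w w'} → w M.≈ w' → f w N.≈ f w'
    g-resp : ∀ {v v'} → v N.≈ v' → g v M.≈ g v'
    g∘f    : ∀ w → g (f w) M.≈ w
    f∘g    : ∀ v → f (g v) N.≈ v
    δ-pres : ∀ w → N.δ (f w) ≡ M.δ w
    R-pres : ∀ a w v → M.R a w v ⇔ N.R a (f w) (f v)
    ρ-pres : ∀ p w → N.ρ p (f w) ≡ M.ρ p w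

data Formula (n : ℕ) (P : Set) : Set where
  pr   : P → Var → Formula n P
  tt   : Formula n P
  neg  : Formula n P → Formula n P
  conj : Formula n P → Formula n P → Formula n P
  asg  : Var → Fin n → Formula n P → Formula n P
  K    : List Var → Formula n P → Formula n P

FV : ∀ {n P} → Formula n P → List Var
FV (pr p x)     = x ∷ []
FV tt           = []
FV (neg φ)      = FV φ
FV (conj φ ψ)   = Data.List._++_ (FV φ) (FV ψ)
FV (asg x a φ)  = filter (λ y → ¬? (y ℕ.≟ x)) (FV φ)
FV (K X α)      = X

Closed : ∀ {n P} → Formula n P → Set
Closed φ = FV φ ≡ []

WF : ∀ {n P} → Formula n P → Set
WF (pr p x)    = ⊤
WF tt          = ⊤
WF (neg φ)     = WF φ
WF (conj φ ψ)  = WF φ × WF ψ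
WF (asg x a φ) = WF φ
WF (K X α)     = Closed α × WF α

Sentence : ∀ {n P} → Formula n P → Set
Sentence φ = WF φ × Closed φ

update : ∀ {n} → (Var → Fin n) → Var → Fin n → (Var → Fin n)
update σ x a y with y ℕ.≟ x
... | yes _ = a
... | no  _ = σ y

Sat : ∀ {n P} (M : PreModel n P) → PreModel.W M → (Var → Fin n) →
      Formula n P → Set
Sat M w σ (pr p x)    = σ x ∈ PreModel.ρ M p w
Sat M w σ tt          = ⊤
Sat M w σ (neg φ)     = ¬ Sat M w σ φ
Sat M w σ (conj φ ψ)  = Sat M w σ φ × Sat M w σ ψ
Sat M w σ (asg x a φ) = a ∈ PreModel.δ M w → Sat M w (update σ x a) φ
Sat M w σ (K X α)     = ∀ v → (∀ x → x ∈ᴸ X → PreModel.R M (σ x) w v) →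
                        Sat M v σ α

-- In a local epistemic model the cells [w]_δ behave like equivalence
-- classes: v ∈ [w]_δ iff [v]_δ = [w]_δ, and then δ and ρ agree at w and v
-- (collectively decreasing domain, local predicates) and every R_a is
-- invariant under moving within cells (local S5).  Hence R^pr_a coincides
-- with R_a on representatives, all structure transfers to M^pr, [w]_δ is
-- the only cell-mate of itself in M^pr, and "having the same cell" is a
-- bisimulation.  A bisimulation preserves L^[:=]-sentences because K_X
-- quantifies over an intersection ⋂_{a ∈ σ[X]} R_a, which the forth and
-- back conditions match for the finite set of agents σ[X].
module Submission where

open import Defs
open import Data.Nat using (ℕ; suc)
open import Data.Fin using (Fin)
open import Data.Fin.Subset using (Subset; _∈_; ⊥; ⁅_⁆; _∪_)
open import Data.Fin.Subset.Properties
  using (_∈?_; ⊆-antisym; ∉⊥; x∈⁅x⁆; x∈⁅y⁆⇒x≡y; x∈p∪q⁺; x∈p∪q⁻)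
open import Data.List using (List; []; _∷_)
open import Data.List.Membership.Propositional using () renaming (_∈_ to _∈ᴸ_)
open import Data.List.Relation.Unary.Any using (here; there)
open import Data.Product using (_×_; _,_)
open import Data.Sum using (inj₁; inj₂)
open import Data.Empty using (⊥-elim)
open import Relation.Nullary using (yes; no)
open import Relation.Binary.PropositionalEquality using (_≡_; refl; sym; subst)
open import Relation.Binary.Structures using (IsEquivalence)
open import Function.Bundles using (_⇔_; _↣_; mk⇔; Equivalence)
import Function.Properties.Equivalence as ⇔

open Equivalence using (to; from)

image : ∀ {n} → (Var → Fin n) → List Var → Subset n
image σ []      = ⊥
image σ (x ∷ X) = ⁅ σ x ⁆ ∪ image σ X

∈-image⁺ : ∀ {n} (σ : Var → Fin n) {x X} → x ∈ᴸ X → σ x ∈ image σ X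
∈-image⁺ σ (here refl) = x∈p∪q⁺ (inj₁ (x∈⁅x⁆ _))
∈-image⁺ σ (there x∈X) = x∈p∪q⁺ (inj₂ (∈-image⁺ σ x∈X))

∀-image⇔ : ∀ {n} {Q : Fin n → Set} (σ : Var → Fin n) (X : List Var) →
           (∀ x → x ∈ᴸ X → Q (σ x)) ⇔ (∀ a → a ∈ image σ X → Q a)
∀-image⇔ {Q = Q} σ X = mk⇔ (forward X) (λ h x x∈X → h (σ x) (∈-image⁺ σ x∈X))
  where
  forward : ∀ X → (∀ x → x ∈ᴸ X → Q (σ x)) → ∀ a → a ∈ image σ X → Q a
  forward []      h a a∈ = ⊥-elim (∉⊥ a∈)
  forward (x ∷ X) h a a∈ with x∈p∪q⁻ ⁅ σ x ⁆ (image σ X) a∈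
  ... | inj₁ a∈⁅σx⁆ = subst Q (sym (x∈⁅y⁆⇒x≡y (σ x) a∈⁅σx⁆)) (h x (here refl))
  ... | inj₂ a∈σX   = forward X (λ y y∈X → h y (there y∈X)) a a∈σX

module BisimulationInvariance {n P} {M N : PreModel n P}
    {Z : PreModel.W M → PreModel.W N → Set} (bisim : IsBisimulation M N Z) where
  open IsBisimulation bisim

  Sat-invariant : ∀ {w v} → Z w v → ∀ σ φ → Sat M w σ φ ⇔ Sat N v σ φ
  Sat-invariant z σ (pr p x) rewrite ρ-eq z p = ⇔.refl
  Sat-invariant z σ tt = ⇔.refl
  Sat-invariant z σ (neg φ) = mk⇔
    (λ ¬s s → ¬s (from (Sat-invariant z σ φ) s))
    (λ ¬s s → ¬s (to (Sat-invariant z σ φ) s))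
  Sat-invariant z σ (conj φ ψ) = mk⇔
    (λ (s , t) → to (Sat-invariant z σ φ) s , to (Sat-invariant z σ ψ) t)
    (λ (s , t) → from (Sat-invariant z σ φ) s , from (Sat-invariant z σ ψ) t)
  Sat-invariant z σ (asg x a φ) = mk⇔
    (λ h a∈ → to (Sat-invariant z (update σ x a) φ) (h (subst (a ∈_) (sym (δ-eq z)) a∈)))
    (λ h a∈ → from (Sat-invariant z (update σ x a) φ) (h (subst (a ∈_) (δ-eq z) a∈)))
  Sat-invariant z σ (K X α) = mk⇔
    (λ h v' r → let (w' , i , z') = back z (image σ X) v' (to (∀-image⇔ σ X) r)
                in to (Sat-invariant z' σ α) (h w' (from (∀-image⇔ σ X) i)))
    (λ h w' r → let (v' , i , z') = forth z (image σ X) w' (to (∀-image⇔ σ X) r)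
                in from (Sat-invariant z' σ α) (h v' (from (∀-image⇔ σ X) i)))

module Properization {n P} (M : PreModel n P) (LE : IsLocalEpistemic M) where
  open PreModel M
  open IsLocalEpistemic LE
  open IsFOKripke isFOKripke

  Mᵖ : PreModel n P
  Mᵖ = properization M

  open PreModel Mᵖ using () renaming (_≈_ to _≈ᵖ_; R to Rᵖ)

  ≈ᵖ-isEquivalence : IsEquivalence _≈ᵖ_
  ≈ᵖ-isEquivalence = record
    { refl  = λ u → ⇔.refl
    ; sym   = λ e u → ⇔.sym (e u)
    ; trans = λ e f u → ⇔.trans (e u) (f u)
    }
  open IsEquivalence ≈ᵖ-isEquivalence public
    using () renaming (refl to ≈ᵖ-refl; sym to ≈ᵖ-sym; trans to ≈ᵖ-trans)

  R⇒∈δ : ∀ {a w v} → R a w v → a ∈ δ w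
  R⇒∈δ {a} {w} r with a ∈? δ w
  ... | yes a∈ = a∈
  ... | no  a∉ = ⊥-elim (R-dom a∉ r)

  Cell-refl : ∀ w → Cell M w w
  Cell-refl w a a∈ = S5-refl a∈

  Cell-sym : ∀ {w v} → Cell M w v → Cell M v w
  Cell-sym c a a∈v = S5-sym (decDom c a∈v) a∈v (c a (decDom c a∈v))

  Cell-trans : ∀ {w v u} → Cell M w v → Cell M v u → Cell M w u
  Cell-trans c d a a∈w =
    let a∈v = incDom a∈w (c a a∈w) in
    S5-trans a∈w a∈v (incDom a∈v (d a a∈v)) (c a a∈w) (d a a∈v)

  ≈⇒Cell : ∀ {w v} → w ≈ v → Cell M w v
  ≈⇒Cell w≈v a a∈ = R-resp (IsEquivalence.refl ≈-equiv) w≈v (S5-refl a∈)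

  Cell⇒δ≡ : ∀ {w v} → Cell M w v → δ w ≡ δ v
  Cell⇒δ≡ c = ⊆-antisym (decDom (Cell-sym c)) (decDom c)

  Cell⇒ρ≡ : ∀ {p w v} → Cell M w v → ρ p w ≡ ρ p v
  Cell⇒ρ≡ {p} {w} {v} c = ⊆-antisym
    (λ a∈ → localPred a∈ (c _ (ρ-dom p w a∈)))
    (λ a∈ → localPred a∈ (Cell-sym c _ (ρ-dom p v a∈)))

  R-Cell-resp : ∀ {a w w' v v'} → Cell M w' w → Cell M v v' → R a w v → R a w' v'
  R-Cell-resp {a} c d r =
    let a∈w  = R⇒∈δ r
        a∈w' = subst (a ∈_) (sym (Cell⇒δ≡ c)) a∈w
        a∈v  = incDom a∈w r
        a∈v' = subst (a ∈_) (Cell⇒δ≡ d) a∈v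
    in S5-trans a∈w' a∈v a∈v' (S5-trans a∈w' a∈w a∈v (c a a∈w') r) (d a a∈v)

  ≈ᵖ⇔Cell : ∀ {w v} → w ≈ᵖ v ⇔ Cell M w v
  ≈ᵖ⇔Cell {w} {v} = mk⇔
    (λ e → from (e v) (Cell-refl v))
    (λ c u → mk⇔ (Cell-trans (Cell-sym c)) (Cell-trans c))

  Rᵖ⇔R : ∀ {a w v} → Rᵖ a w v ⇔ R a w v
  Rᵖ⇔R = mk⇔
    (λ (w' , v' , w≈w' , v≈v' , r) →
       R-Cell-resp (to ≈ᵖ⇔Cell w≈w') (Cell-sym (to ≈ᵖ⇔Cell v≈v')) r)
    (λ r → _ , _ , ≈ᵖ-refl , ≈ᵖ-refl , r)

  isFOKripkeᵖ : IsFOKripke Mᵖ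
  isFOKripkeᵖ = record
    { inhabited  = inhabited
    ; ≈-equiv    = ≈ᵖ-isEquivalence
    ; δ-resp     = λ e → Cell⇒δ≡ (to ≈ᵖ⇔Cell e)
    ; ρ-resp     = λ e → Cell⇒ρ≡ (to ≈ᵖ⇔Cell e)
    ; R-resp     = λ e f (w , v , x≈w , y≈v , r) →
                     w , v , ≈ᵖ-trans (≈ᵖ-sym e) x≈w , ≈ᵖ-trans (≈ᵖ-sym f) y≈v , r
    ; δ-nonempty = δ-nonempty
    ; R-dom      = λ a∉ r → R-dom a∉ (to Rᵖ⇔R r)
    ; ρ-dom      = ρ-dom
    }

  isLocalEpistemicᵖ : IsLocalEpistemic Mᵖ
  isLocalEpistemicᵖ = record
    { isFOKripke = isFOKripkeᵖ
    ; S5-refl    = λ a∈ → from Rᵖ⇔R (S5-refl a∈)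
    ; S5-sym     = λ a∈ b∈ r → from Rᵖ⇔R (S5-sym a∈ b∈ (to Rᵖ⇔R r))
    ; S5-trans   = λ a∈ b∈ c∈ r s → from Rᵖ⇔R (S5-trans a∈ b∈ c∈ (to Rᵖ⇔R r) (to Rᵖ⇔R s))
    ; incDom     = λ a∈ r → incDom a∈ (to Rᵖ⇔R r)
    ; localPred  = λ a∈ r → localPred a∈ (to Rᵖ⇔R r)
    ; decDom     = λ c → decDom (λ a a∈ → to Rᵖ⇔R (c a a∈))
    }

  Cellᵖ⇔Cell : ∀ {w v} → Cell Mᵖ w v ⇔ Cell M w v
  Cellᵖ⇔Cell = mk⇔ (λ c a a∈ → to Rᵖ⇔R (c a a∈)) (λ c a a∈ → from Rᵖ⇔R (c a a∈))

  isProperᵖ : IsProper Mᵖ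
  isProperᵖ w v = ⇔.trans Cellᵖ⇔Cell
    (mk⇔ (λ c → from ≈ᵖ⇔Cell (Cell-sym c)) (λ e → Cell-sym (to ≈ᵖ⇔Cell e)))

  sameCell-isBisimulation : IsBisimulation M Mᵖ _≈ᵖ_
  sameCell-isBisimulation = record
    { Z-resp = λ w≈w' v≈v' z → ≈ᵖ-trans (≈ᵖ-trans (≈ᵖ-sym (from ≈ᵖ⇔Cell (≈⇒Cell w≈w'))) z) v≈v'
    ; δ-eq   = λ z → Cell⇒δ≡ (to ≈ᵖ⇔Cell z)
    ; ρ-eq   = λ z p → Cell⇒ρ≡ (to ≈ᵖ⇔Cell z)
    ; forth  = λ z A w' i → w' ,
        (λ a a∈A → from Rᵖ⇔R (R-Cell-resp (Cell-sym (to ≈ᵖ⇔Cell z)) (Cell-refl w') (i a a∈A))) ,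
        ≈ᵖ-refl
    ; back   = λ z A v' i → v' ,
        (λ a a∈A → R-Cell-resp (to ≈ᵖ⇔Cell z) (Cell-refl v') (to Rᵖ⇔R (i a a∈A))) ,
        ≈ᵖ-refl
    }

  proper⇒isomorphic : IsProper M → Isomorphic M Mᵖ
  proper⇒isomorphic proper = record
    { f      = λ w → w
    ; g      = λ w → w
    ; f-resp = λ w≈v → from ≈ᵖ⇔Cell (≈⇒Cell w≈v)
    ; g-resp = λ {w} {v} e → to (proper v w) (Cell-sym (to ≈ᵖ⇔Cell e))
    ; g∘f    = λ w → IsEquivalence.refl ≈-equiv
    ; f∘g    = λ w → ≈ᵖ-refl
    ; δ-pres = λ w → refl
    ; R-pres = λ a w v → ⇔.sym Rᵖ⇔R
    ; ρ-pres = λ p w → refl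
    }

mainTheorem3 : (k : ℕ) (P : Set) → P ↣ ℕ →
    (M : PreModel (suc k) P) → IsLocalEpistemic M →
    ( IsLocalEpistemic (properization M)
    × IsProper (properization M)
    × (∀ w → Bisimilar M w (properization M) w)
    × (∀ w (φ : Formula (suc k) P) → Sentence φ → (σ : ℕ → Fin (suc k)) →
         Sat M w σ φ ⇔ Sat (properization M) w σ φ) )
    × (IsProper M → Isomorphic M (properization M))
mainTheorem3 k P _ M LE =
  ( isLocalEpistemicᵖ
  , isProperᵖ
  , (λ w → _ , sameCell-isBisimulation , ≈ᵖ-refl)
  , (λ w φ _ σ → Sat-invariant ≈ᵖ-refl σ φ) )
  , proper⇒isomorphic
  where
  open Properization M LE
  open BisimulationInvariance sameCell-isBisimulation
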